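{- Let $G$ be a hypergraph, $e_\bot\in E(G)$, and $\mathcal{T}=(T,\mathcal{L})$ an $e_\bot$-rooted superbranch decomposition of $G$. Let $t$ be an internal node of $T$ with parent $p$ such that $\mathcal{L}[c]$ is well-linked in $G$ for every child $c$ of $t$, and let $e_p\in E(\mathrm{torso}(t))$ be the hyperedge of $\mathrm{torso}(t)$ corresponding to $p$. Then a set $A\subseteq E(\mathrm{torso}(t))\setminus\{e_p\}$ is well-linked in $\mathrm{torso}(t)$ if and only if $A\triangleright\mathcal{T}$ is well-linked in $G$.
   Context: A hypergraph $G$ consists of a finite vertex set $V(G)$, a finite set $E(G)$ of hyperedges, and a map assigning to each $e\in E(G)$ a set $V(e)\subseteq V(G)$ (distinct hyperedges may have the same vertex set), with $V(G)=\bigcup_{e\in E(G)}V(e)$. For $A\subseteq E(G)$ let $V(A)=\bigcup_{e\in A}V(e)$, $\overline{A}=E(G)\setminus A$, $\mathrm{bd}(A)=V(A)\cap V(\overline{A})$ and $\lambda(A)=|\mathrm{bd}(A)|$. A set $A\subseteq E(G)$ is well-linked if for every bipartition $(C_1,C_2)$ of $A$, $\lambda(C_1)\ge\lambda(A)$ or $\lambda(C_2)\ge\lambda(A)$. A superbranch decomposition of $G$ is a pair $(T,\mathcal{L})$ where $T$ is a tree whose non-leaf nodes all have degree at least $3$ (leaves are nodes of degree at most $1$) and $\mathcal{L}$ is a bijection from the leaves of $T$ to $E(G)$. For an edge $uv$ of $T$, $\mathcal{L}(\vec{uv})$ is the set of hyperedges $e$ such that the path from $\mathcal{L}^{ -1}(e)$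 to $v$ contains $u$; the adhesion is $\mathrm{adh}(uv)=\mathrm{bd}(\mathcal{L}(\vec{uv}))$. For an internal node $t$, $\mathrm{torso}(t)$ is the hypergraph with one hyperedge $e_s$ for every neighbor $s$ of $t$ in $T$, with $V(e_s)=\mathrm{adh}(st)$, and vertex set the union of these. For $A\subseteq E(\mathrm{torso}(t))$, $A\triangleright\mathcal{T}=\bigcup_{e_s\in A}\mathcal{L}(\vec{st})$. The decomposition is $e$-rooted if $T$ is rooted at the leaf $\mathcal{L}^{ -1}(e)$; then $\mathcal{L}[t]$ denotes the set of hyperedges mapped to leaves that are descendants of $t$ (every node is its own descendant). -}

module Defs where

open import Data.Nat using (ℕ; zero; suc; _+_; _≤_; _≥_; _<_; _≤?_)
open import Data.Fin using (Fin; zero; suc; toℕ; _≟_)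
open import Data.Bool using (Bool; true; false; _∧_; _∨_; not; if_then_else_)
open import Data.Product using (_×_; ∃)
open import Data.Sum using (_⊎_)
open import Relation.Binary.PropositionalEquality using (_≡_; _≢_)
open import Relation.Nullary.Decidable using (⌊_⌋)

count : ∀ {n} → (Fin n → Bool) → ℕ
count {zero}  f = 0
count {suc n} f = (if f zero then 1 else 0) + count (λ i → f (suc i))

anyF : ∀ {n} → (Fin n → Bool) → Bool
anyF {zero}  f = false
anyF {suc n} f = f zero ∨ anyF (λ i → f (suc i))

iter : ∀ {A : Set} → (A → A) → ℕ → A → A
iter f zero    x = x
iter f (suc k) x = f (iter f k x)

-- Vertices are drawn from Fin nV and hyperedge *indices* from Fin nE;
-- the actual hyperedge set is E = { e | isE e ≡ true }, V(e) = { v | inc e v ≡ true },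
-- and the actual vertex set is V(G) = ⋃_{e ∈ E} V(e).  (Unused indices are bookkeeping
-- and play no role in any notion below.)  Distinct hyperedges may share a vertex set.

record Hypergraph : Set where
  field
    nV  : ℕ
    nE  : ℕ
    isE : Fin nE → Bool
    inc : Fin nE → Fin nV → Bool

open Hypergraph public

-- a set of hyperedges, read as { e ∈ E | A e ≡ true }
EdgeSet : Hypergraph → Set
EdgeSet H = Fin (nE H) → Bool

module _ (H : Hypergraph) where

  VofB : EdgeSet H → Fin (nV H) → Bool
  VofB A v = anyF (λ e → isE H e ∧ A e ∧ inc H e v)

  compl : EdgeSet H → EdgeSet H
  compl A e = isE H e ∧ not (A e)

  bdB : EdgeSet H → Fin (nV H) → Bool
  bdB A v = VofB A v ∧ VofB (compl A) v

  lam : EdgeSet H → ℕ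
  lam A = count (bdB A)

  IsBipartition : EdgeSet H → EdgeSet H → EdgeSet H → Set
  IsBipartition A C₁ C₂ =
    ∀ e → isE H e ≡ true → (A e ≡ (C₁ e ∨ C₂ e)) × (C₁ e ∧ C₂ e ≡ false)

  WellLinked : EdgeSet H → Set
  WellLinked A = ∀ C₁ C₂ → IsBipartition A C₁ C₂ → (lam C₁ ≥ lam A) ⊎ (lam C₂ ≥ lam A)

-- The (undirected) tree T has edges { x , par x } for x ≠ root; the depth function
-- witnesses that following parents always reaches the root (so T is a tree).

record RootedTree (N : ℕ) : Set where
  field
    root      : Fin N
    par       : Fin N → Fin N
    par-root  : par root ≡ root
    depth     : Fin N → ℕ
    depth-par : ∀ x → x ≢ root → depth x ≡ suc (depth (par x))

module TreeNotions {N : ℕ} (T : RootedTree N) where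
  open RootedTree T

  isRootB : Fin N → Bool
  isRootB x = ⌊ x ≟ root ⌋

  adjB : Fin N → Fin N → Bool
  adjB x y = (not (isRootB x) ∧ ⌊ par x ≟ y ⌋) ∨ (not (isRootB y) ∧ ⌊ par y ≟ x ⌋)

  degree : Fin N → ℕ
  degree x = count (adjB x)

  Leaf : Fin N → Set
  Leaf x = degree x ≤ 1

  leafB : Fin N → Bool
  leafB x = ⌊ degree x ≤? 1 ⌋

  Internal : Fin N → Set
  Internal x = 1 < degree x

  IsChild : Fin N → Fin N → Set
  IsChild c t = c ≢ root × par c ≡ t

  descB : Fin N → Fin N → Bool
  descB x y = anyF {suc N} (λ k → ⌊ iter par (toℕ k) y ≟ x ⌋)

record SBD (G : Hypergraph) : Set where
  field
    N      : ℕ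
    tree   : RootedTree N
    lab    : Fin N → Fin (nE G)        -- 𝓛, meaningful on leaves
    lab-E    : ∀ x → TreeNotions.Leaf tree x → isE G (lab x) ≡ true
    lab-inj  : ∀ x y → TreeNotions.Leaf tree x → TreeNotions.Leaf tree y → lab x ≡ lab y → x ≡ y
    lab-surj : ∀ e → isE G e ≡ true → ∃ λ x → TreeNotions.Leaf tree x × lab x ≡ e
    deg-ok   : ∀ x → TreeNotions.Leaf tree x ⊎ 3 ≤ TreeNotions.degree tree x

module SBDNotions {G : Hypergraph} (D : SBD G) where
  open SBD D public
  open RootedTree tree public
  open TreeNotions tree public

  RootedAt : Fin (nE G) → Set
  RootedAt e = Leaf root × lab root ≡ e

  Lsub : Fin N → EdgeSet G
  Lsub x e = anyF (λ y → leafB y ∧ descB x y ∧ ⌊ lab y ≟ e ⌋)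

  -- 𝓛(u→v) for adjacent u, v: the hyperedges whose leaf-to-v path contains u.
  -- If u is a child of v this is 𝓛[u]; if v is a child of u it is E ∖ 𝓛[v].
  Ldir : Fin N → Fin N → EdgeSet G
  Ldir u v e = if (not (isRootB u) ∧ ⌊ par u ≟ v ⌋) then Lsub u e else compl G (Lsub v) e

  adhB : Fin N → Fin N → Fin (nV G) → Bool
  adhB u v = bdB G (Ldir u v)

  torso : Fin N → Hypergraph
  torso t = record
    { nV  = nV G
    ; nE  = N
    ; isE = λ s → adjB s t
    ; inc = λ s → adhB s t
    }

  tri : (t : Fin N) → EdgeSet (torso t) → EdgeSet G
  tri t A e = anyF (λ s → adjB s t ∧ A s ∧ Ldir s t e)

-- Around t, the sets 𝓛(s→t) for the neighbours s of t partition E(G), and torso(t) is the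
-- hypergraph obtained by contracting each part to one hyperedge whose vertices are the boundary
-- of that part. A vertex is on the boundary of a union of parts iff it is on the boundary of a
-- part inside and of a part outside the union, so λ(B ▷ 𝓣) = λ(B) for every B ⊆ E(torso t), and
-- bipartitions of A lift to bipartitions of A ▷ 𝓣; this gives one direction.
-- Conversely, let (C₁, C₂) bipartition A ▷ 𝓣 and let X = 𝓛[c] be a part with e_c ∈ A (a child
-- of t, as e_p ∉ A). Since X is well-linked, say λ(C₁ ∩ X) ≥ λ(X); submodularity and
-- posimodularity of λ then show that (C₁ ∪ X, C₂ ∖ X) has no larger λ on either side. Uncrossing
-- the parts one at a time gives a bipartition (A₁ ▷ 𝓣, A₂ ▷ 𝓣) with λ(Aᵢ ▷ 𝓣) ≤ λ(Cᵢ), and the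
-- well-linkedness of A in the torso concludes.

{-# OPTIONS --safe #-}
module Submission where

open import Defs
open import Data.Nat using (ℕ; zero; suc; _+_; _∸_; _≤_; _≥_; _<_; _≤?_; _<?_; z≤n; s≤s)
open import Data.Nat.Properties
  using (≤-refl; ≤-trans; +-mono-≤; +-monoʳ-≤; +-cancelʳ-≤; +-cancelʳ-≡; +-suc; m∸n+n≡m; m<n⇒m<1+n; ≮⇒≥; <⇒≱;
         +-commutativeSemigroup; module ≤-Reasoning)
open import Algebra.Properties.CommutativeSemigroup +-commutativeSemigroup using (interchange)
open import Data.Fin using (Fin; zero; suc; toℕ; fromℕ<; _≟_)
open import Data.Fin.Properties using (pigeonhole; toℕ-injective; toℕ-fromℕ<; toℕ≤pred[n]; <⇒≢)
open import Data.Bool using (Bool; true; false; _∧_; _∨_; not; if_then_else_)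
open import Data.Bool.Properties
  using (∧-conicalˡ; ∧-conicalʳ; ∨-conicalˡ; ∨-conicalʳ; ∧-comm; ∨-comm; ∧-zeroʳ; ∨-zeroʳ; ∧-identityʳ; ∨-identityʳ;
         not-injective; not-¬; ¬-not; if-not; if-cong; if-cong₂)
open import Data.Product using (_×_; _,_; ∃; proj₁; proj₂)
import Data.Product as Product
open import Data.Sum using (_⊎_; inj₁; inj₂)
import Data.Sum as Sum
open import Data.Empty using (⊥-elim)
open import Data.List using (List; []; _∷_; allFin)
open import Data.List.Membership.Propositional using (_∈_)
open import Data.List.Membership.Propositional.Properties using (∈-allFin)
open import Data.List.Relation.Unary.Any using (here; there)
open import Function using (_∘_; id)
open import Function.Bundles using (_⇔_; mk⇔)
open import Relation.Nullary using (Dec; yes; no; ¬_)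
open import Relation.Nullary.Decidable using (⌊_⌋)
open import Relation.Nullary.Negation using (contradiction)
open import Relation.Binary.PropositionalEquality

∧-true : ∀ {a b} → a ≡ true → b ≡ true → a ∧ b ≡ true
∧-true refl refl = refl

∨-true⁻ : ∀ a {b} → a ∨ b ≡ true → a ≡ true ⊎ b ≡ true
∨-true⁻ true  _ = inj₁ refl
∨-true⁻ false p = inj₂ p

not-true⁻ : ∀ {a} → not a ≡ true → a ≡ false
not-true⁻ {false} _ = refl

not-false⁻ : ∀ {a} → not a ≡ false → a ≡ true
not-false⁻ {true} _ = refl

∨-trueˡ : ∀ {a} b → a ≡ true → a ∨ b ≡ true
∨-trueˡ b refl = refl

∨-trueʳ : ∀ a {b} → b ≡ true → a ∨ b ≡ true
∨-trueʳ a refl = ∨-zeroʳ a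

≡-from-true⇔ : ∀ {a b} → (a ≡ true → b ≡ true) → (b ≡ true → a ≡ true) → a ≡ b
≡-from-true⇔ {true}  {true}  _ _ = refl
≡-from-true⇔ {true}  {false} f _ = sym (f refl)
≡-from-true⇔ {false} {true}  _ g = g refl
≡-from-true⇔ {false} {false} _ _ = refl

⌊⌋-true : ∀ {P : Set} (d : Dec P) → P → ⌊ d ⌋ ≡ true
⌊⌋-true (yes _) _ = refl
⌊⌋-true (no ¬p) p = contradiction p ¬p

⌊⌋-false : ∀ {P : Set} (d : Dec P) → ¬ P → ⌊ d ⌋ ≡ false
⌊⌋-false (yes p) ¬p = contradiction p ¬p
⌊⌋-false (no _)  _  = refl

⌊⌋-true⁻ : ∀ {P : Set} (d : Dec P) → ⌊ d ⌋ ≡ true → P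
⌊⌋-true⁻ (yes p) _ = p

⌊⌋-false⁻ : ∀ {P : Set} (d : Dec P) → ⌊ d ⌋ ≡ false → ¬ P
⌊⌋-false⁻ (no ¬p) _ = ¬p

select : ∀ {n} → Bool → (Fin n → Bool) → (Fin n → Bool) → Fin n → Bool
select b X Y i = if b then X i else Y i

_∪_ _∩_ _∖_ : ∀ {n} → (Fin n → Bool) → (Fin n → Bool) → Fin n → Bool
(X ∪ Y) i = X i ∨ Y i
(X ∩ Y) i = X i ∧ Y i
(X ∖ Y) i = X i ∧ not (Y i)

anyF-intro : ∀ {n} (f : Fin n → Bool) i → f i ≡ true → anyF f ≡ true
anyF-intro f zero    p = ∨-trueˡ _ p
anyF-intro f (suc i) p = ∨-trueʳ (f zero) (anyF-intro (f ∘ suc) i p)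

anyF-witness : ∀ {n} (f : Fin n → Bool) → anyF f ≡ true → ∃ λ i → f i ≡ true
anyF-witness {suc n} f p with ∨-true⁻ (f zero) p
... | inj₁ q = zero , q
... | inj₂ q = Product.map suc id (anyF-witness (f ∘ suc) q)

anyF-cong : ∀ {n} {f g : Fin n → Bool} → (∀ i → f i ≡ g i) → anyF f ≡ anyF g
anyF-cong {zero}  _   = refl
anyF-cong {suc n} f≗g = cong₂ _∨_ (f≗g zero) (anyF-cong (f≗g ∘ suc))

iverson : Bool → ℕ
iverson b = if b then 1 else 0

count-cong : ∀ {n} {f g : Fin n → Bool} → (∀ i → f i ≡ g i) → count f ≡ count g
count-cong {zero}  _   = refl
count-cong {suc n} f≗g = cong₂ _+_ (cong iverson (f≗g zero)) (count-cong (f≗g ∘ suc))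

count-+-mono : ∀ {n} (f g h k : Fin n → Bool) →
               (∀ i → iverson (f i) + iverson (g i) ≤ iverson (h i) + iverson (k i)) →
               count f + count g ≤ count h + count k
count-+-mono {zero}  _ _ _ _ _ = z≤n
count-+-mono {suc n} f g h k p =
  subst₂ _≤_ (interchange (iverson (f zero)) (iverson (g zero)) (count (f ∘ suc)) (count (g ∘ suc)))
             (interchange (iverson (h zero)) (iverson (k zero)) (count (h ∘ suc)) (count (k ∘ suc)))
    (+-mono-≤ (p zero) (count-+-mono (f ∘ suc) (g ∘ suc) (h ∘ suc) (k ∘ suc) (p ∘ suc)))

iverson-+-mono : ∀ a b c d → (a ∧ b ≡ true → c ∧ d ≡ true) → (a ∨ b ≡ true → c ∨ d ≡ true) →
                 iverson a + iverson b ≤ iverson c + iverson d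
iverson-+-mono false false c     d     _    _    = z≤n
iverson-+-mono true  false c     d     _    some = at-least-one c d (some refl)
  where
  at-least-one : ∀ c d → c ∨ d ≡ true → 1 ≤ iverson c + iverson d
  at-least-one true  _    _ = s≤s z≤n
  at-least-one false true _ = s≤s z≤n
iverson-+-mono false true  c     d     _    some = iverson-+-mono true false c d (λ ()) some
iverson-+-mono true  true  true  true  _    _    = ≤-refl
iverson-+-mono true  true  true  false both _    with () ← both refl
iverson-+-mono true  true  false d     both _    with () ← both refl

exchange-≤ : ∀ {a b c x} → a + c ≤ b + x → x ≤ c → a ≤ b
exchange-≤ {a} {b} {c} a+c≤b+x x≤c = +-cancelʳ-≤ c a b (≤-trans a+c≤b+x (+-monoʳ-≤ b x≤c))

module Cuts (G : Hypergraph) where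

  _⊆_ _≐_ : EdgeSet G → EdgeSet G → Set
  X ⊆ Y = ∀ e → isE G e ≡ true → X e ≡ true → Y e ≡ true
  X ≐ Y = ∀ e → isE G e ≡ true → X e ≡ Y e

  record OnBoundary (A : EdgeSet G) (v : Fin (nV G)) : Set where
    constructor straddle
    field
      inner outer : Fin (nE G)
      inner∈E : isE G inner ≡ true
      inner∈A : A inner ≡ true
      v∈inner : inc G inner v ≡ true
      outer∈E : isE G outer ≡ true
      outer∉A : A outer ≡ false
      v∈outer : inc G outer v ≡ true

  VofB-intro : ∀ {A v} e → isE G e ≡ true → A e ≡ true → inc G e v ≡ true → VofB G A v ≡ true
  VofB-intro e e∈E e∈A v∈e = anyF-intro _ e (∧-true e∈E (∧-true e∈A v∈e))

  VofB-witness : ∀ {A v} → VofB G A v ≡ true →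
                 ∃ λ e → isE G e ≡ true × A e ≡ true × inc G e v ≡ true
  VofB-witness {A} p with anyF-witness _ p
  ... | e , q = e , ∧-conicalˡ (isE G e) _ q , ∧-conicalˡ (A e) _ (∧-conicalʳ (isE G e) _ q)
        , ∧-conicalʳ (A e) _ (∧-conicalʳ (isE G e) _ q)

  bd-intro : ∀ {A v} → OnBoundary A v → bdB G A v ≡ true
  bd-intro (straddle e f e∈E e∈A v∈e f∈E f∉A v∈f) =
    ∧-true (VofB-intro e e∈E e∈A v∈e) (VofB-intro f f∈E (∧-true f∈E (cong not f∉A)) v∈f)

  bd-elim : ∀ {A v} → bdB G A v ≡ true → OnBoundary A v
  bd-elim {A} {v} p with VofB-witness (∧-conicalˡ (VofB G A v) _ p) | VofB-witness (∧-conicalʳ (VofB G A v) _ p)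
  ... | e , e∈E , e∈A , v∈e | f , f∈E , f∈Ā , v∈f =
    straddle e f e∈E e∈A v∈e f∈E (not-injective (∧-conicalʳ (isE G f) _ f∈Ā)) v∈f

  VofB-cong : ∀ {A B} → A ≐ B → ∀ v → VofB G A v ≡ VofB G B v
  VofB-cong {A} {B} A≐B v = anyF-cong pointwise
    where
    pointwise : ∀ e → (isE G e ∧ A e ∧ inc G e v) ≡ (isE G e ∧ B e ∧ inc G e v)
    pointwise e with isE G e in e∈E
    ... | true  = cong (_∧ inc G e v) (A≐B e e∈E)
    ... | false = refl

  compl-cong : ∀ {A B} → A ≐ B → compl G A ≐ compl G B
  compl-cong A≐B e e∈E = cong (λ b → isE G e ∧ not b) (A≐B e e∈E)

  lam-cong : ∀ {A B} → A ≐ B → lam G A ≡ lam G B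
  lam-cong A≐B = count-cong λ v → cong₂ _∧_ (VofB-cong A≐B v) (VofB-cong (compl-cong A≐B) v)

  WellLinked-cong : ∀ {A B} → A ≐ B → WellLinked G A → WellLinked G B
  WellLinked-cong A≐B wlA C₁ C₂ bip =
    Sum.map (subst (lam G C₁ ≥_) (lam-cong A≐B)) (subst (lam G C₂ ≥_) (lam-cong A≐B))
      (wlA C₁ C₂ λ e e∈E → trans (A≐B e e∈E) (proj₁ (bip e e∈E)) , proj₂ (bip e e∈E))

  lam-+-mono : ∀ A B C D →
               (∀ v → bdB G A v ∧ bdB G B v ≡ true → bdB G C v ∧ bdB G D v ≡ true) →
               (∀ v → bdB G A v ∨ bdB G B v ≡ true → bdB G C v ∨ bdB G D v ≡ true) →
               lam G A + lam G B ≤ lam G C + lam G D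
  lam-+-mono A B C D both either = count-+-mono (bdB G A) (bdB G B) (bdB G C) (bdB G D) λ v →
    iverson-+-mono (bdB G A v) (bdB G B v) (bdB G C v) (bdB G D v) (both v) (either v)

  lam-submodular : ∀ A B → lam G (A ∪ B) + lam G (A ∩ B) ≤ lam G A + lam G B
  lam-submodular A B = lam-+-mono (A ∪ B) (A ∩ B) A B both either
    where
    both : ∀ v → bdB G (A ∪ B) v ∧ bdB G (A ∩ B) v ≡ true → bdB G A v ∧ bdB G B v ≡ true
    both v p with bd-elim (∧-conicalˡ (bdB G (A ∪ B) v) _ p) | bd-elim (∧-conicalʳ (bdB G (A ∪ B) v) _ p)
    ... | straddle _ f _ _ _ f∈E f∉A∪B v∈f | straddle e _ e∈E e∈A∩B v∈e _ _ _ =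
      ∧-true (bd-intro (straddle e f e∈E (∧-conicalˡ (A e) _ e∈A∩B) v∈e f∈E (∨-conicalˡ (A f) _ f∉A∪B) v∈f))
             (bd-intro (straddle e f e∈E (∧-conicalʳ (A e) _ e∈A∩B) v∈e f∈E (∨-conicalʳ (A f) _ f∉A∪B) v∈f))
    either : ∀ v → bdB G (A ∪ B) v ∨ bdB G (A ∩ B) v ≡ true → bdB G A v ∨ bdB G B v ≡ true
    either v p with ∨-true⁻ (bdB G (A ∪ B) v) p
    either v p | inj₁ q with bd-elim q
    ... | straddle e f e∈E e∈A∪B v∈e f∈E f∉A∪B v∈f with ∨-true⁻ (A e) e∈A∪B
    ... | inj₁ e∈A = ∨-trueˡ _ (bd-intro (straddle e f e∈E e∈A v∈e f∈E (∨-conicalˡ (A f) _ f∉A∪B) v∈f))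
    ... | inj₂ e∈B = ∨-trueʳ _ (bd-intro (straddle e f e∈E e∈B v∈e f∈E (∨-conicalʳ (A f) _ f∉A∪B) v∈f))
    either v p | inj₂ q with bd-elim q
    ... | straddle e f e∈E e∈A∩B v∈e f∈E f∉A∩B v∈f with A f in f∈?A
    ... | false = ∨-trueˡ _ (bd-intro (straddle e f e∈E (∧-conicalˡ (A e) _ e∈A∩B) v∈e f∈E f∈?A v∈f))
    ... | true  = ∨-trueʳ _ (bd-intro (straddle e f e∈E (∧-conicalʳ (A e) _ e∈A∩B) v∈e f∈E f∉A∩B v∈f))

  lam-posimodular : ∀ A B → lam G (A ∖ B) + lam G (B ∖ A) ≤ lam G A + lam G B
  lam-posimodular A B = lam-+-mono (A ∖ B) (B ∖ A) A B both either
    where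
    both : ∀ v → bdB G (A ∖ B) v ∧ bdB G (B ∖ A) v ≡ true → bdB G A v ∧ bdB G B v ≡ true
    both v p with bd-elim (∧-conicalˡ (bdB G (A ∖ B) v) _ p) | bd-elim (∧-conicalʳ (bdB G (A ∖ B) v) _ p)
    ... | straddle e _ e∈E e∈A∖B v∈e _ _ _ | straddle f _ f∈E f∈B∖A v∈f _ _ _ =
      ∧-true (bd-intro (straddle e f e∈E (∧-conicalˡ (A e) _ e∈A∖B) v∈e f∈E (not-true⁻ (∧-conicalʳ (B f) _ f∈B∖A)) v∈f))
             (bd-intro (straddle f e f∈E (∧-conicalˡ (B f) _ f∈B∖A) v∈f e∈E (not-true⁻ (∧-conicalʳ (A e) _ e∈A∖B)) v∈e))
    one-side : ∀ X Y v → bdB G (X ∖ Y) v ≡ true → bdB G X v ∨ bdB G Y v ≡ true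
    one-side X Y v p with bd-elim p
    ... | straddle e f e∈E e∈X∖Y v∈e f∈E f∉X∖Y v∈f with X f in f∈?X
    ... | false = ∨-trueˡ _ (bd-intro (straddle e f e∈E (∧-conicalˡ (X e) _ e∈X∖Y) v∈e f∈E f∈?X v∈f))
    ... | true  = ∨-trueʳ _ (bd-intro (straddle f e f∈E (not-false⁻ f∉X∖Y) v∈f e∈E (not-true⁻ (∧-conicalʳ (X e) _ e∈X∖Y)) v∈e))
    either : ∀ v → bdB G (A ∖ B) v ∨ bdB G (B ∖ A) v ≡ true → bdB G A v ∨ bdB G B v ≡ true
    either v p with ∨-true⁻ (bdB G (A ∖ B) v) p
    ... | inj₁ q = one-side A B v q
    ... | inj₂ q = subst (_≡ true) (∨-comm (bdB G B v) _) (one-side B A v q)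

  -- The possible values of (Z e, C₁ e, C₂ e, X e) for e ∈ E when (C₁, C₂) bipartitions Z and X ⊆ Z.
  data Position : Bool → Bool → Bool → Bool → Set where
    in-C₁   : ∀ {x} → Position true true false x
    in-C₂   : ∀ {x} → Position true false true x
    outside : Position false false false false

  position : ∀ {Z C₁ C₂ X} → IsBipartition G Z C₁ C₂ → X ⊆ Z →
             ∀ e → isE G e ≡ true → Position (Z e) (C₁ e) (C₂ e) (X e)
  position bip X⊆Z e e∈E = classify (proj₁ (bip e e∈E)) (proj₂ (bip e e∈E)) (X⊆Z e e∈E)
    where
    classify : ∀ {z c₁ c₂ x} → z ≡ c₁ ∨ c₂ → c₁ ∧ c₂ ≡ false → (x ≡ true → z ≡ true) → Position z c₁ c₂ x
    classify {c₁ = true}  {false}         refl _ _   = in-C₁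
    classify {c₁ = false} {true}          refl _ _   = in-C₂
    classify {c₁ = false} {false} {false} refl _ _   = outside
    classify {c₁ = false} {false} {true}  refl _ x⇒z with () ← x⇒z refl
    classify {c₁ = true}  {true}          _    ()

  bipartition-swap : ∀ {Z C₁ C₂} → IsBipartition G Z C₁ C₂ → IsBipartition G Z C₂ C₁
  bipartition-swap {C₁ = C₁} {C₂} bip e e∈E =
    trans (proj₁ (bip e e∈E)) (∨-comm (C₁ e) (C₂ e)) , trans (∧-comm (C₂ e) (C₁ e)) (proj₂ (bip e e∈E))

  bipartition-⊆ˡ : ∀ {Z C₁ C₂} → IsBipartition G Z C₁ C₂ → C₁ ⊆ Z
  bipartition-⊆ˡ bip e e∈E e∈C₁ = trans (proj₁ (bip e e∈E)) (∨-trueˡ _ e∈C₁)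

  bipartition-split : ∀ A S → IsBipartition G A (A ∩ S) (A ∖ S)
  bipartition-split A S e _ = split (A e) (S e)
    where
    split : ∀ a s → (a ≡ (a ∧ s) ∨ (a ∧ not s)) × ((a ∧ s) ∧ (a ∧ not s) ≡ false)
    split true  true  = refl , refl
    split true  false = refl , refl
    split false _     = refl , refl

  bipartition-restrict : ∀ {Z C₁ C₂ X} → IsBipartition G Z C₁ C₂ → X ⊆ Z →
                         IsBipartition G X (C₁ ∩ X) (C₂ ∩ X)
  bipartition-restrict {Z} {C₁} {C₂} {X} bip X⊆Z e e∈E = restrict (position {Z} {C₁} {C₂} {X} bip X⊆Z e e∈E)
    where
    restrict : ∀ {z c₁ c₂ x} → Position z c₁ c₂ x → (x ≡ (c₁ ∧ x) ∨ (c₂ ∧ x)) × ((c₁ ∧ x) ∧ (c₂ ∧ x) ≡ false)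
    restrict (in-C₁ {true})  = refl , refl
    restrict (in-C₁ {false}) = refl , refl
    restrict (in-C₂ {x})     = refl , refl
    restrict outside         = refl , refl

  bipartition-absorb : ∀ {Z C₁ C₂ X} → IsBipartition G Z C₁ C₂ → X ⊆ Z →
                       IsBipartition G Z (C₁ ∪ X) (C₂ ∖ X)
  bipartition-absorb {Z} {C₁} {C₂} {X} bip X⊆Z e e∈E = absorb (position {Z} {C₁} {C₂} {X} bip X⊆Z e e∈E)
    where
    absorb : ∀ {z c₁ c₂ x} → Position z c₁ c₂ x → (z ≡ (c₁ ∨ x) ∨ (c₂ ∧ not x)) × ((c₁ ∨ x) ∧ (c₂ ∧ not x) ≡ false)
    absorb in-C₁           = refl , refl
    absorb (in-C₂ {true})  = refl , refl
    absorb (in-C₂ {false}) = refl , refl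
    absorb outside         = refl , refl

  ∖-bipartition≐ : ∀ {Z C₁ C₂ X} → IsBipartition G Z C₁ C₂ → X ⊆ Z → (X ∖ C₂) ≐ (C₁ ∩ X)
  ∖-bipartition≐ {Z} {C₁} {C₂} {X} bip X⊆Z e e∈E = outside-C₂ (position {Z} {C₁} {C₂} {X} bip X⊆Z e e∈E)
    where
    outside-C₂ : ∀ {z c₁ c₂ x} → Position z c₁ c₂ x → x ∧ not c₂ ≡ c₁ ∧ x
    outside-C₂ (in-C₁ {true})  = refl
    outside-C₂ (in-C₁ {false}) = refl
    outside-C₂ (in-C₂ {true})  = refl
    outside-C₂ (in-C₂ {false}) = refl
    outside-C₂ outside         = refl

  record Uncrossed (Z C₁ C₂ X : EdgeSet G) : Set where
    field
      D₁ D₂       : EdgeSet G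
      bipartition : IsBipartition G Z D₁ D₂
      lam₁≤       : lam G D₁ ≤ lam G C₁
      lam₂≤       : lam G D₂ ≤ lam G C₂
      side        : Bool
      X⊆side      : X ⊆ select side D₁ D₂
      unchanged   : ∀ e → isE G e ≡ true → X e ≡ false → D₁ e ≡ C₁ e × D₂ e ≡ C₂ e

  absorb : ∀ {Z C₁ C₂ X} → IsBipartition G Z C₁ C₂ → X ⊆ Z → lam G (C₁ ∩ X) ≥ lam G X →
           Uncrossed Z C₁ C₂ X
  absorb {Z} {C₁} {C₂} {X} bip X⊆Z X≤C₁∩X = record
    { D₁          = C₁ ∪ X
    ; D₂          = C₂ ∖ X
    ; bipartition = bipartition-absorb {Z} {C₁} {C₂} {X} bip X⊆Z
    ; lam₁≤       = exchange-≤ (lam-submodular C₁ X) X≤C₁∩X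
    ; lam₂≤       = exchange-≤ posimodular X≤C₁∩X
    ; side        = true
    ; X⊆side      = λ e _ e∈X → ∨-trueʳ (C₁ e) e∈X
    ; unchanged   = λ e _ e∉X → unchanged e∉X
    }
    where
    posimodular : lam G (C₂ ∖ X) + lam G (C₁ ∩ X) ≤ lam G C₂ + lam G X
    posimodular = subst (λ k → lam G (C₂ ∖ X) + k ≤ lam G C₂ + lam G X)
                        (lam-cong (∖-bipartition≐ {Z} {C₁} {C₂} {X} bip X⊆Z)) (lam-posimodular C₂ X)
    unchanged : ∀ {e} → X e ≡ false → (C₁ e ∨ X e ≡ C₁ e) × (C₂ e ∧ not (X e) ≡ C₂ e)
    unchanged {e} e∉X rewrite e∉X = ∨-identityʳ (C₁ e) , ∧-identityʳ (C₂ e)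

  Uncrossed-swap : ∀ {Z C₁ C₂ X} → Uncrossed Z C₂ C₁ X → Uncrossed Z C₁ C₂ X
  Uncrossed-swap {Z} {C₁} {C₂} u = record
    { D₁          = D₂
    ; D₂          = D₁
    ; bipartition = bipartition-swap {Z} {D₁} {D₂} bipartition
    ; lam₁≤       = lam₂≤
    ; lam₂≤       = lam₁≤
    ; side        = not side
    ; X⊆side      = λ e e∈E e∈X → trans (if-not side) (X⊆side e e∈E e∈X)
    ; unchanged   = λ e e∈E e∉X → Product.swap (unchanged e e∈E e∉X)
    }
    where open Uncrossed u

  uncross : ∀ {Z C₁ C₂ X} → IsBipartition G Z C₁ C₂ → X ⊆ Z → WellLinked G X → Uncrossed Z C₁ C₂ X
  uncross {Z} {C₁} {C₂} {X} bip X⊆Z wlX with wlX (C₁ ∩ X) (C₂ ∩ X) (bipartition-restrict {Z} {C₁} {C₂} bip X⊆Z)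
  ... | inj₁ X≤C₁∩X = absorb bip X⊆Z X≤C₁∩X
  ... | inj₂ X≤C₂∩X = Uncrossed-swap (absorb (bipartition-swap {Z} {C₁} bip) X⊆Z X≤C₂∩X)

module Contraction (G : Hypergraph) {N : ℕ} (isPart : Fin N → Bool) (L : Fin N → EdgeSet G)
  (parts-disjoint : ∀ s r e → isE G e ≡ true → isPart s ≡ true → isPart r ≡ true →
                    L s e ≡ true → L r e ≡ true → s ≡ r)
  (parts-cover : ∀ e → isE G e ≡ true → ∃ λ s → isPart s ≡ true × L s e ≡ true) where

  open Cuts G

  H : Hypergraph
  H = record { nV = nV G ; nE = N ; isE = isPart ; inc = λ s → bdB G (L s) }

  module H = Cuts H

  expand : EdgeSet H → EdgeSet G
  expand A e = anyF (λ s → isPart s ∧ A s ∧ L s e)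

  expand-intro : ∀ {A e} s → isPart s ≡ true → A s ≡ true → L s e ≡ true → expand A e ≡ true
  expand-intro s s∈P s∈A e∈Ls = anyF-intro _ s (∧-true s∈P (∧-true s∈A e∈Ls))

  expand-witness : ∀ {A e} → expand A e ≡ true → ∃ λ s → isPart s ≡ true × A s ≡ true × L s e ≡ true
  expand-witness {A} p with anyF-witness _ p
  ... | s , q = s , ∧-conicalˡ (isPart s) _ q , ∧-conicalˡ (A s) _ (∧-conicalʳ (isPart s) _ q)
              , ∧-conicalʳ (A s) _ (∧-conicalʳ (isPart s) _ q)

  expand-mono : ∀ {B A} → B H.⊆ A → expand B ⊆ expand A
  expand-mono B⊆A e _ e∈B with expand-witness e∈B
  ... | s , s∈P , s∈B , e∈Ls = expand-intro s s∈P (B⊆A s s∈P s∈B) e∈Ls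

  part⊆expand : ∀ {A s} → isPart s ≡ true → A s ≡ true → L s ⊆ expand A
  part⊆expand {s = s} s∈P s∈A e _ e∈Ls = expand-intro s s∈P s∈A e∈Ls

  part∉expand : ∀ {A s e} → isE G e ≡ true → isPart s ≡ true → A s ≡ false → L s e ≡ true → expand A e ≡ false
  part∉expand {A} e∈E s∈P s∉A e∈Ls = ¬-not λ e∈A →
    let r , r∈P , r∈A , e∈Lr = expand-witness e∈A
    in not-¬ (subst (λ x → A x ≡ true) (parts-disjoint r _ _ e∈E r∈P s∈P e∈Lr e∈Ls) r∈A) s∉A

  lam-expand : ∀ B → lam H B ≡ lam G (expand B)
  lam-expand B = count-cong λ v → ≡-from-true⇔ (to v) (from v)
    where
    to : ∀ v → bdB H B v ≡ true → bdB G (expand B) v ≡ true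
    to v p with H.bd-elim p
    ... | H.straddle s r s∈P s∈B v∈bdLs r∈P r∉B v∈bdLr with bd-elim v∈bdLs | bd-elim v∈bdLr
    ... | straddle e _ e∈E e∈Ls v∈e _ _ _ | straddle f _ f∈E f∈Lr v∈f _ _ _ =
      bd-intro (straddle e f e∈E (expand-intro s s∈P s∈B e∈Ls) v∈e f∈E (part∉expand f∈E r∈P r∉B f∈Lr) v∈f)
    from : ∀ v → bdB G (expand B) v ≡ true → bdB H B v ≡ true
    from v p with bd-elim p
    ... | straddle e f e∈E e∈B v∈e f∈E f∉B v∈f with expand-witness e∈B | parts-cover f f∈E
    ... | s , s∈P , s∈B , e∈Ls | r , r∈P , f∈Lr =
      H.bd-intro (H.straddle s r s∈P s∈B (bd-intro (straddle e f e∈E e∈Ls v∈e f∈E f∉Ls v∈f))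
                             r∈P r∉B (bd-intro (straddle f e f∈E f∈Lr v∈f e∈E e∉Lr v∈e)))
      where
      r∉B : B r ≡ false
      r∉B = ¬-not λ r∈B → not-¬ (expand-intro r r∈P r∈B f∈Lr) f∉B
      f∉Ls : L s f ≡ false
      f∉Ls = ¬-not λ f∈Ls → not-¬ (expand-intro s s∈P s∈B f∈Ls) f∉B
      e∉Lr : L r e ≡ false
      e∉Lr = ¬-not λ e∈Lr → not-¬ e∈B (part∉expand e∈E r∈P r∉B e∈Lr)

  expand-bipartition : ∀ {A C₁ C₂} → IsBipartition H A C₁ C₂ →
                       IsBipartition G (expand A) (expand C₁) (expand C₂)
  expand-bipartition {A} {C₁} {C₂} bip e e∈E = ≡-from-true⇔ split join , ¬-not disjoint
    where
    split : expand A e ≡ true → expand C₁ e ∨ expand C₂ e ≡ true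
    split e∈A with expand-witness e∈A
    ... | s , s∈P , s∈A , e∈Ls with ∨-true⁻ (C₁ s) (trans (sym (proj₁ (bip s s∈P))) s∈A)
    ... | inj₁ s∈C₁ = ∨-trueˡ _ (expand-intro s s∈P s∈C₁ e∈Ls)
    ... | inj₂ s∈C₂ = ∨-trueʳ _ (expand-intro s s∈P s∈C₂ e∈Ls)
    join : expand C₁ e ∨ expand C₂ e ≡ true → expand A e ≡ true
    join p with ∨-true⁻ (expand C₁ e) p
    ... | inj₁ e∈C₁ = expand-mono (H.bipartition-⊆ˡ {A} {C₁} {C₂} bip) e e∈E e∈C₁
    ... | inj₂ e∈C₂ = expand-mono (H.bipartition-⊆ˡ {A} {C₂} {C₁} (H.bipartition-swap {A} {C₁} {C₂} bip)) e e∈E e∈C₂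
    disjoint : expand C₁ e ∧ expand C₂ e ≢ true
    disjoint p with expand-witness (∧-conicalˡ (expand C₁ e) _ p) | expand-witness (∧-conicalʳ (expand C₁ e) _ p)
    ... | s , s∈P , s∈C₁ , e∈Ls | r , r∈P , r∈C₂ , e∈Lr with parts-disjoint s r e e∈E s∈P r∈P e∈Ls e∈Lr
    ... | refl = not-¬ (∧-true s∈C₁ r∈C₂) (proj₂ (bip s s∈P))

  expand-reflects-WellLinked : ∀ {A} → WellLinked G (expand A) → WellLinked H A
  expand-reflects-WellLinked {A} wl C₁ C₂ bip =
    Sum.map (subst₂ _≥_ (sym (lam-expand C₁)) (sym (lam-expand A)))
            (subst₂ _≥_ (sym (lam-expand C₂)) (sym (lam-expand A)))
            (wl (expand C₁) (expand C₂) (expand-bipartition {A} {C₁} {C₂} bip))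

  expand-select≐ : ∀ {A D D′} (τ : Fin N → Bool) → IsBipartition G (expand A) D D′ →
                   (∀ s → isPart s ≡ true → A s ≡ true → L s ⊆ select (τ s) D D′) →
                   expand (A ∩ τ) ≐ D
  expand-select≐ {A} {D} {D′} τ bip sided e e∈E = ≡-from-true⇔ to from
    where
    to : expand (A ∩ τ) e ≡ true → D e ≡ true
    to p with expand-witness p
    ... | s , s∈P , s∈A∩τ , e∈Ls =
      trans (sym (if-cong (∧-conicalʳ (A s) _ s∈A∩τ))) (sided s s∈P (∧-conicalˡ (A s) _ s∈A∩τ) e e∈E e∈Ls)
    from : D e ≡ true → expand (A ∩ τ) e ≡ true
    from e∈D with expand-witness (bipartition-⊆ˡ {expand A} {D} {D′} bip e e∈E e∈D)
    ... | s , s∈P , s∈A , e∈Ls with τ s in τs | sided s s∈P s∈A e e∈E e∈Ls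
    ... | true  | _    = expand-intro s s∈P (∧-true s∈A τs) e∈Ls
    ... | false | e∈D′ = ⊥-elim (not-¬ (∧-true e∈D e∈D′) (proj₂ (bip e e∈E)))

  module _ {A : EdgeSet H} (parts-WellLinked : ∀ s → isPart s ≡ true → A s ≡ true → WellLinked G (L s))
           {C₁ C₂ : EdgeSet G} (C-bipartition : IsBipartition G (expand A) C₁ C₂) where

    record Refinement (l : List (Fin N)) : Set where
      field
        D₁ D₂       : EdgeSet G
        bipartition : IsBipartition G (expand A) D₁ D₂
        lam₁≤       : lam G D₁ ≤ lam G C₁
        lam₂≤       : lam G D₂ ≤ lam G C₂
        side        : Fin N → Bool
        parts-sided : ∀ s → s ∈ l → isPart s ≡ true → A s ≡ true → L s ⊆ select (side s) D₁ D₂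

    refine-skip : ∀ {s l} → isPart s ∧ A s ≡ false → Refinement l → Refinement (s ∷ l)
    refine-skip {s} {l} s-unused r = record
      { D₁ = D₁ ; D₂ = D₂ ; bipartition = bipartition ; lam₁≤ = lam₁≤ ; lam₂≤ = lam₂≤
      ; side = side ; parts-sided = sided }
      where
      open Refinement r
      sided : ∀ q → q ∈ s ∷ l → isPart q ≡ true → A q ≡ true → L q ⊆ select (side q) D₁ D₂
      sided _ (here refl) s∈P s∈A = ⊥-elim (not-¬ (∧-true s∈P s∈A) s-unused)
      sided q (there q∈l)         = parts-sided q q∈l

    refine-uncross : ∀ {s l} → isPart s ≡ true → A s ≡ true → Refinement l → Refinement (s ∷ l)
    refine-uncross {s} {l} s∈P s∈A r = record
      { D₁ = U.D₁ ; D₂ = U.D₂ ; bipartition = U.bipartition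
      ; lam₁≤ = ≤-trans U.lam₁≤ lam₁≤ ; lam₂≤ = ≤-trans U.lam₂≤ lam₂≤
      ; side = side′ ; parts-sided = sided }
      where
      open Refinement r
      module U = Uncrossed (uncross {expand A} {D₁} {D₂} bipartition (part⊆expand s∈P s∈A)
                                    (parts-WellLinked s s∈P s∈A))
      side′ : Fin N → Bool
      side′ q = if ⌊ q ≟ s ⌋ then U.side else side q
      sided : ∀ q → q ∈ s ∷ l → isPart q ≡ true → A q ≡ true → L q ⊆ select (side′ q) U.D₁ U.D₂
      sided q q∈s∷l q∈P q∈A e e∈E e∈Lq with q ≟ s | q∈s∷l
      ... | yes refl | _         = U.X⊆side e e∈E e∈Lq
      ... | no q≢s   | here q≡s  = contradiction q≡s q≢s
      ... | no q≢s   | there q∈l =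
        trans (if-cong₂ (side q) (proj₁ kept) (proj₂ kept)) (parts-sided q q∈l q∈P q∈A e e∈E e∈Lq)
        where
        kept : U.D₁ e ≡ D₁ e × U.D₂ e ≡ D₂ e
        kept = U.unchanged e e∈E (¬-not λ e∈Ls → q≢s (parts-disjoint q s e e∈E q∈P s∈P e∈Lq e∈Ls))

    refine : ∀ l → Refinement l
    refine [] = record
      { D₁ = C₁ ; D₂ = C₂ ; bipartition = C-bipartition ; lam₁≤ = ≤-refl ; lam₂≤ = ≤-refl
      ; side = λ _ → true ; parts-sided = λ _ () }
    refine (s ∷ l) with isPart s ∧ A s in s-used
    ... | false = refine-skip s-used (refine l)
    ... | true  = refine-uncross (∧-conicalˡ (isPart s) _ s-used) (∧-conicalʳ (isPart s) _ s-used) (refine l)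

  expand-preserves-WellLinked : ∀ {A} → (∀ s → isPart s ≡ true → A s ≡ true → WellLinked G (L s)) →
                                WellLinked H A → WellLinked G (expand A)
  expand-preserves-WellLinked {A} parts-wl wlA C₁ C₂ bip = conclude (refine parts-wl bip (allFin N))
    where
    bound : ∀ {B D C} → expand B ≐ D → lam G D ≤ lam G C → lam H B ≥ lam H A → lam G C ≥ lam G (expand A)
    bound {B} {D} {C} B≐D D≤C A≤B = begin
      lam G (expand A) ≡⟨ lam-expand A ⟨
      lam H A          ≤⟨ A≤B ⟩
      lam H B          ≡⟨ lam-expand B ⟩
      lam G (expand B) ≡⟨ lam-cong B≐D ⟩
      lam G D          ≤⟨ D≤C ⟩
      lam G C          ∎
      where open ≤-Reasoning
    conclude : Refinement parts-wl bip (allFin N) → lam G C₁ ≥ lam G (expand A) ⊎ lam G C₂ ≥ lam G (expand A)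
    conclude r = Sum.map (bound expand₁≐ lam₁≤) (bound expand₂≐ lam₂≤)
                         (wlA (A ∩ side) (A ∖ side) (H.bipartition-split A side))
      where
      open Refinement r
      sided : ∀ s → isPart s ≡ true → A s ≡ true → L s ⊆ select (side s) D₁ D₂
      sided s = parts-sided s (∈-allFin s)
      expand₁≐ : expand (A ∩ side) ≐ D₁
      expand₁≐ = expand-select≐ side bipartition sided
      expand₂≐ : expand (A ∖ side) ≐ D₂
      expand₂≐ = expand-select≐ (not ∘ side) (bipartition-swap {expand A} {D₁} {D₂} bipartition)
                   λ s s∈P s∈A e e∈E e∈Ls → trans (if-not (side s)) (sided s s∈P s∈A e e∈E e∈Ls)

  WellLinked-expand⇔ : ∀ A → (∀ s → isPart s ≡ true → A s ≡ true → WellLinked G (L s)) →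
                       WellLinked H A ⇔ WellLinked G (expand A)
  WellLinked-expand⇔ A parts-wl = mk⇔ (expand-preserves-WellLinked parts-wl) expand-reflects-WellLinked

module Ancestors {N : ℕ} (T : RootedTree N) where
  open RootedTree T
  open TreeNotions T

  iter-par-root : ∀ k → iter par k root ≡ root
  iter-par-root zero    = refl
  iter-par-root (suc k) = trans (cong par (iter-par-root k)) par-root

  iter-par-+ : ∀ j k y → iter par (j + k) y ≡ iter par j (iter par k y)
  iter-par-+ zero    k y = refl
  iter-par-+ (suc j) k y = cong par (iter-par-+ j k y)

  par-≢root⁻ : ∀ {z} → par z ≢ root → z ≢ root
  par-≢root⁻ pz≢root refl = pz≢root par-root

  depth-iter : ∀ k x → iter par k x ≢ root → depth x ≡ k + depth (iter par k x)
  depth-iter zero    x _  = refl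
  depth-iter (suc k) x nr = begin
    depth x                              ≡⟨ depth-iter k x (par-≢root⁻ nr) ⟩
    k + depth (iter par k x)             ≡⟨ cong (k +_) (depth-par _ (par-≢root⁻ nr)) ⟩
    k + suc (depth (iter par (suc k) x)) ≡⟨ +-suc k _ ⟩
    suc k + depth (iter par (suc k) x)   ∎
    where open ≡-Reasoning

  iter-par-injective : ∀ {j k y z} → iter par j y ≡ z → iter par k y ≡ z → z ≢ root → j ≡ k
  iter-par-injective {j} {k} {y} refl q z≢root = +-cancelʳ-≡ _ j k (begin
    j + depth (iter par j y) ≡⟨ depth-iter j y z≢root ⟨
    depth y                  ≡⟨ depth-iter k y (λ r → z≢root (trans (sym q) r)) ⟩
    k + depth (iter par k y) ≡⟨ cong (λ w → k + depth w) q ⟩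
    k + depth (iter par j y) ∎)
    where open ≡-Reasoning

  iter-par-≢root : ∀ {i k y} → i ≤ k → iter par k y ≢ root → iter par i y ≢ root
  iter-par-≢root {i} {k} {y} i≤k nr i-root = nr (begin
    iter par k y                    ≡⟨ cong (λ m → iter par m y) (m∸n+n≡m i≤k) ⟨
    iter par (k ∸ i + i) y          ≡⟨ iter-par-+ (k ∸ i) i y ⟩
    iter par (k ∸ i) (iter par i y) ≡⟨ cong (iter par (k ∸ i)) i-root ⟩
    iter par (k ∸ i) root           ≡⟨ iter-par-root (k ∸ i) ⟩
    root                            ∎)
    where open ≡-Reasoning

  -- y, par y, …, parᵏ y have pairwise distinct depths, so they are k + 1 distinct nodes.
  ancestor-distance< : ∀ k y → iter par k y ≢ root → k < N
  ancestor-distance< k y nr with k <? N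
  ... | yes k<N = k<N
  ... | no  k≮N with pigeonhole (s≤s (≮⇒≥ k≮N)) (λ (i : Fin (suc k)) → iter par (toℕ i) y)
  ... | i , j , i<j , same = ⊥-elim (<⇒≢ i<j (toℕ-injective (iter-par-injective same refl
                                 (iter-par-≢root (toℕ≤pred[n] j) nr))))

  descB-intro : ∀ {x y} k → x ≢ root → iter par k y ≡ x → descB x y ≡ true
  descB-intro {x} {y} k x≢root k-up =
    anyF-intro (λ (i : Fin (suc N)) → ⌊ iter par (toℕ i) y ≟ x ⌋) (fromℕ< k<1+N)
      (⌊⌋-true (iter par (toℕ (fromℕ< k<1+N)) y ≟ x) (trans (cong (λ m → iter par m y) (toℕ-fromℕ< k<1+N)) k-up))
    where
    k<1+N : k < suc N
    k<1+N = m<n⇒m<1+n (ancestor-distance< k y λ k-root → x≢root (trans (sym k-up) k-root))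

  descB-witness : ∀ {x y} → descB x y ≡ true → ∃ λ k → iter par k y ≡ x
  descB-witness {x} {y} p with anyF-witness (λ (i : Fin (suc N)) → ⌊ iter par (toℕ i) y ≟ x ⌋) p
  ... | i , q = toℕ i , ⌊⌋-true⁻ (iter par (toℕ i) y ≟ x) q

module DecompositionFacts {G : Hypergraph} (D : SBD G) where
  open SBDNotions D
  open Ancestors tree

  Lsub-intro : ∀ {x e} y k → x ≢ root → Leaf y → iter par k y ≡ x → lab y ≡ e → Lsub x e ≡ true
  Lsub-intro {x} {e} y k x≢root y-leaf k-up y↦e =
    anyF-intro (λ z → leafB z ∧ descB x z ∧ ⌊ lab z ≟ e ⌋) y
      (∧-true (⌊⌋-true (degree y ≤? 1) y-leaf) (∧-true (descB-intro k x≢root k-up) (⌊⌋-true (lab y ≟ e) y↦e)))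

  LeafBelow : Fin N → Fin (nE G) → Set
  LeafBelow x e = ∃ λ y → Leaf y × (∃ λ k → iter par k y ≡ x) × lab y ≡ e

  Lsub-witness : ∀ {x e} → Lsub x e ≡ true → LeafBelow x e
  Lsub-witness {x} {e} p with anyF-witness (λ z → leafB z ∧ descB x z ∧ ⌊ lab z ≟ e ⌋) p
  ... | y , q = y , ⌊⌋-true⁻ (degree y ≤? 1) (∧-conicalˡ (leafB y) _ q)
                  , descB-witness (∧-conicalˡ (descB x y) _ (∧-conicalʳ (leafB y) _ q))
                  , ⌊⌋-true⁻ (lab y ≟ e) (∧-conicalʳ (descB x y) _ (∧-conicalʳ (leafB y) _ q))

  childB-true : ∀ {c t} → IsChild c t → not (isRootB c) ∧ ⌊ par c ≟ t ⌋ ≡ true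
  childB-true {c} {t} (c≢root , c↑t) = ∧-true (cong not (⌊⌋-false (c ≟ root) c≢root)) (⌊⌋-true (par c ≟ t) c↑t)

  childB-true⁻ : ∀ c t → not (isRootB c) ∧ ⌊ par c ≟ t ⌋ ≡ true → IsChild c t
  childB-true⁻ c t p = ⌊⌋-false⁻ (c ≟ root) (not-injective (∧-conicalˡ (not (isRootB c)) _ p))
                     , ⌊⌋-true⁻ (par c ≟ t) (∧-conicalʳ (not (isRootB c)) _ p)

  adjB-child : ∀ {c t} → IsChild c t → adjB c t ≡ true
  adjB-child c-child = ∨-trueˡ _ (childB-true c-child)

  adjB-par : ∀ {t} → t ≢ root → adjB (par t) t ≡ true
  adjB-par {t} t≢root = ∨-trueʳ _ (childB-true (t≢root , refl))

  neighbour-view : ∀ {s t} → adjB s t ≡ true → IsChild s t ⊎ s ≡ par t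
  neighbour-view {s} {t} p =
    Sum.map (childB-true⁻ s t) (sym ∘ proj₂ ∘ childB-true⁻ t s) (∨-true⁻ (not (isRootB s) ∧ ⌊ par s ≟ t ⌋) p)

  par-par≢ : ∀ {t} → t ≢ root → par (par t) ≢ t
  par-par≢ t≢root pp≡t with () ← iter-par-injective {2} {0} pp≡t refl t≢root

  Ldir-child : ∀ {c t} → IsChild c t → ∀ e → Ldir c t e ≡ Lsub c e
  Ldir-child c-child e = if-cong (childB-true c-child)

  Ldir-par : ∀ {t} → t ≢ root → ∀ e → Ldir (par t) t e ≡ compl G (Lsub t) e
  Ldir-par {t} t≢root e =
    if-cong (trans (cong (not (isRootB (par t)) ∧_) (⌊⌋-false (par (par t) ≟ t) (par-par≢ t≢root))) (∧-zeroʳ _))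

  Lsub-par : ∀ {c t e} → t ≢ root → IsChild c t → Lsub c e ≡ true → Lsub t e ≡ true
  Lsub-par {c} {t} {e} t≢root (_ , c↑t) p = lift (Lsub-witness {c} {e} p)
    where
    lift : LeafBelow c e → Lsub t e ≡ true
    lift (y , y-leaf , (k , k-up) , y↦e) =
      Lsub-intro {t} {e} y (suc k) t≢root y-leaf (trans (cong par k-up) c↑t) y↦e

  Lsub-children-disjoint : ∀ {t c d e} → t ≢ root → IsChild c t → IsChild d t →
                           Lsub c e ≡ true → Lsub d e ≡ true → c ≡ d
  Lsub-children-disjoint {t} {c} {d} {e} t≢root (_ , c↑t) (_ , d↑t) p q =
    same-leaf (Lsub-witness {c} {e} p) (Lsub-witness {d} {e} q)
    where
    same-leaf : LeafBelow c e → LeafBelow d e → c ≡ d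
    same-leaf (y , y-leaf , (j , j-up) , y↦e) (z , z-leaf , (k , k-up) , z↦e)
      with refl ← lab-inj y z y-leaf z-leaf (trans y↦e (sym z↦e))
      with refl ← iter-par-injective {suc j} {suc k} (trans (cong par j-up) c↑t) (trans (cong par k-up) d↑t) t≢root
      = trans (sym j-up) k-up

  Ldir-child-par-disjoint : ∀ {c t e} → t ≢ root → IsChild c t → Ldir c t e ≡ true → Ldir (par t) t e ≢ true
  Ldir-child-par-disjoint {e = e} t≢root c-child e∈c e∈p =
    not-¬ (Lsub-par t≢root c-child (trans (sym (Ldir-child c-child e)) e∈c))
          (not-injective (∧-conicalʳ (isE G e) _ (trans (sym (Ldir-par t≢root e)) e∈p)))

  Ldir-disjoint : ∀ {t} → t ≢ root → ∀ s r {e} → adjB s t ≡ true → adjB r t ≡ true →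
                  Ldir s t e ≡ true → Ldir r t e ≡ true → s ≡ r
  Ldir-disjoint {t} t≢root s r {e} s~t r~t e∈s e∈r with neighbour-view {s} {t} s~t | neighbour-view {r} {t} r~t
  ... | inj₂ refl    | inj₂ refl    = refl
  ... | inj₁ s-child | inj₂ refl    = ⊥-elim (Ldir-child-par-disjoint t≢root s-child e∈s e∈r)
  ... | inj₂ refl    | inj₁ r-child = ⊥-elim (Ldir-child-par-disjoint t≢root r-child e∈r e∈s)
  ... | inj₁ s-child | inj₁ r-child =
    Lsub-children-disjoint t≢root s-child r-child (trans (sym (Ldir-child s-child e)) e∈s)
                                                  (trans (sym (Ldir-child r-child e)) e∈r)

  Ldir-cover : ∀ {t} → Internal t → t ≢ root → ∀ e → isE G e ≡ true →
               ∃ λ s → adjB s t ≡ true × Ldir s t e ≡ true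
  Ldir-cover {t} t-internal t≢root e e∈E = cover (Lsub t e) refl
    where
    cover : ∀ b → Lsub t e ≡ b → ∃ λ s → adjB s t ≡ true × Ldir s t e ≡ true
    cover false e∉t = par t , adjB-par t≢root , trans (Ldir-par t≢root e) (∧-true e∈E (cong not e∉t))
    cover true  e∈t = below-child (Lsub-witness {t} {e} e∈t)
      where
      below-child : LeafBelow t e → ∃ λ s → adjB s t ≡ true × Ldir s t e ≡ true
      below-child (y , y-leaf , (zero , refl) , _) = ⊥-elim (<⇒≱ t-internal y-leaf)
      below-child (y , y-leaf , (suc k , k-up) , y↦e) =
        iter par k y , adjB-child c-child
                     , trans (Ldir-child c-child e) (Lsub-intro {iter par k y} {e} y k c≢root y-leaf refl y↦e)
        where
        c≢root : iter par k y ≢ root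
        c≢root c-root = t≢root (trans (sym k-up) (trans (cong par c-root) par-root))
        c-child : IsChild (iter par k y) t
        c-child = c≢root , k-up

lemma4p3 : (G : Hypergraph) (e⊥ : Fin (nE G)) → isE G e⊥ ≡ true →
           (D : SBD G) → SBDNotions.RootedAt D e⊥ →
           (t p : Fin (SBD.N D)) → SBDNotions.Internal D t → SBDNotions.par D t ≡ p →
           (∀ c → SBDNotions.IsChild D c t → WellLinked G (SBDNotions.Lsub D c)) →
           (A : EdgeSet (SBDNotions.torso D t)) →
           (∀ s → A s ≡ true → (SBDNotions.adjB D s t ≡ true) × (s ≢ p)) →
           WellLinked (SBDNotions.torso D t) A ⇔ WellLinked G (SBDNotions.tri D t A)
lemma4p3 G _ _ D (root-leaf , _) t _ t-internal refl children-wl A A-children =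
  WellLinked-expand⇔ A parts-wl
  where
  open SBDNotions D
  open DecompositionFacts D
  open Cuts G using (WellLinked-cong)
  t≢root : t ≢ root
  t≢root t-root = <⇒≱ t-internal (subst Leaf (sym t-root) root-leaf)
  -- Contraction.H is definitionally torso t, and expand is tri t.
  open Contraction G (λ s → adjB s t) (λ s → Ldir s t)
                   (λ s r _ _ → Ldir-disjoint t≢root s r) (Ldir-cover t-internal t≢root)
  parts-wl : ∀ s → adjB s t ≡ true → A s ≡ true → WellLinked G (Ldir s t)
  parts-wl s s~t s∈A with neighbour-view s~t
  ... | inj₁ s-child = WellLinked-cong (λ e _ → sym (Ldir-child s-child e)) (children-wl s s-child)
  ... | inj₂ refl    = ⊥-elim (proj₂ (A-children s s∈A) refl)
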